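{- Let $r$ be a positive integer, let $H$ be a graph of girth at least $2r+3$ which is not a tree, and let $G=H^r$. For $w\in V(H)$ let $B_w=N_G(w)\cup\{w\}$. Then for every vertex $v$ of $\mathrm{core}(H)$ and every $d=1,\ldots,r$, $$T_v^{(d)}=\bigcap_{\substack{a\in V(\mathrm{core}(H))\\ \mathrm{dist}_H(v,a)\leq r-d}}B_a\ \setminus \bigcup_{\substack{b\in V(\mathrm{core}(H))\\ \mathrm{dist}_H(v,b)\geq r-d+1}}B_b.$$
   Context: All graphs are simple, undirected and connected. $H^r$ is the graph on $V(H)$ in which two distinct vertices are adjacent iff their distance in $H$ is at most $r$. For a graph $H$ that is not a tree, $\mathrm{core}(H)$ is the largest subgraph of $H$ with no vertices of degree one. Non-core vertices form trees attached to the core: for a core vertex $v$, $T_v$ is the tree consisting of $v$ together with all non-core vertices whose closest core vertex is $v$, and $T_v^{(d)}$ is the set of vertices of $T_v$ at distance exactly $d$ from $v$. -}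

module Defs where

open import Data.Nat using (ℕ; zero; suc; _+_; _≤_; _<_)
open import Data.Bool using (Bool; true; false)
open import Data.Fin using (Fin; inject₁; fromℕ) renaming (zero to fzero; suc to fsuc)
open import Data.Fin.Subset using (Subset; _∈_; _∉_; _⊆_; _∩_; ∣_∣)
open import Data.Vec using (tabulate)
open import Data.Product using (Σ; ∃; _×_; _,_)
open import Data.Sum using (_⊎_)
open import Function.Definitions using (Injective)
open import Relation.Nullary using (¬_)
open import Relation.Binary.PropositionalEquality using (_≡_; _≢_)

record Graph (n : ℕ) : Set where
  field
    adj    : Fin n → Fin n → Bool
    sym    : ∀ u v → adj u v ≡ adj v u
    irrefl : ∀ v → adj v v ≡ false
open Graph public

Adj : ∀ {n} → Graph n → Fin n → Fin n → Set
Adj H u v = adj H u v ≡ true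

data Walk {n} (H : Graph n) : Fin n → Fin n → ℕ → Set where
  nil  : ∀ {u} → Walk H u u 0
  cons : ∀ {u w v k} → Adj H u w → Walk H w v k → Walk H u v (suc k)

Connected : ∀ {n} → Graph n → Set
Connected H = ∀ u v → ∃ λ k → Walk H u v k

DistLe : ∀ {n} → Graph n → Fin n → Fin n → ℕ → Set
DistLe H u v k = ∃ λ j → j ≤ k × Walk H u v j

Dist : ∀ {n} → Graph n → Fin n → Fin n → ℕ → Set
Dist H u v d = Walk H u v d × (∀ j → j < d → ¬ Walk H u v j)

record Cycle {n} (H : Graph n) : Set where
  field
    m      : ℕ
    vert   : Fin (suc (suc (suc m))) → Fin n
    inj    : Injective _≡_ _≡_ vert
    step   : ∀ (i : Fin (suc (suc m))) → Adj H (vert (inject₁ i)) (vert (fsuc i))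
    close  : Adj H (vert (fromℕ (suc (suc m)))) (vert fzero)
open Cycle public

cycleLength : ∀ {n} {H : Graph n} → Cycle H → ℕ
cycleLength c = suc (suc (suc (m c)))

-- girth(H) ≥ g  (vacuous for acyclic graphs, whose girth is ∞)
GirthAtLeast : ∀ {n} → Graph n → ℕ → Set
GirthAtLeast H g = (c : Cycle H) → g ≤ cycleLength c

IsTree : ∀ {n} → Graph n → Set
IsTree H = Connected H × ¬ Cycle H

Nbhd : ∀ {n} → Graph n → Fin n → Subset n
Nbhd H v = tabulate (adj H v)

MinDeg2 : ∀ {n} → Graph n → Subset n → Set
MinDeg2 H S = ∀ v → v ∈ S → 2 ≤ ∣ Nbhd H v ∩ S ∣

IsCore : ∀ {n} → Graph n → Subset n → Set
IsCore H C = MinDeg2 H C × (∀ S → MinDeg2 H S → S ⊆ C)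

PowerAdj : ∀ {n} → Graph n → ℕ → Fin n → Fin n → Set
PowerAdj H r u v = u ≢ v × DistLe H u v r

B : ∀ {n} → Graph n → ℕ → Fin n → Fin n → Set
B H r w u = u ≡ w ⊎ PowerAdj H r w u

ClosestCore : ∀ {n} → Graph n → Subset n → Fin n → Fin n → Set
ClosestCore H C v u = v ∈ C × (∀ a → a ∈ C → a ≢ v → ∀ da dv → Dist H u a da → Dist H u v dv → dv < da)

InT : ∀ {n} → Graph n → Subset n → Fin n → Fin n → Set
InT H C v u = u ≡ v ⊎ (u ∉ C × ClosestCore H C v u)

InTd : ∀ {n} → Graph n → Subset n → Fin n → ℕ → Fin n → Set
InTd H C v d u = InT H C v u × Dist H v u d

module Submission where

-- Every vertex u has an attachment: a core
-- vertex w at distance j from u such that every walk from u into the core has length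
-- ≥ j and can be rerouted through w (AttachedAt u w j).  For non-core u this rests on
-- the maximality of the core: two walks leaving u and entering the core at different
-- vertices would put u into a set of minimum degree two.  Both sides of the theorem
-- are shown equivalent to "u is attached to v at height d":
--   * for T_v^(d) this says that v is the closest core vertex, at distance d;
--   * for the ball conditions, an attachment (w, j) with s = dist(w, v) forces
--     j + s ≤ d and d + s ≤ j, by testing the conditions on core vertices b placed at
--     prescribed distances behind v or w.  Such b exist because non-backtracking
--     walks prolong inside the core, and a non-backtracking walk of length at most half
--     the girth is a shortest path (a shorter walk would close a short cycle).

open import Defs hiding (sym)
open import Data.Nat using (ℕ; zero; suc; _+_; _*_; _∸_; _≤_; _<_; z≤n; s≤s; _≟_; _≤?_)
open import Data.Nat.Properties
open import Data.Bool using (Bool; true) renaming (_≟_ to _≟ᵇ_)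
open import Data.Unit using (⊤; tt)
open import Data.Fin using (Fin; toℕ)
open import Data.Fin.Properties using (any?; toℕ-injective; toℕ-inject₁; toℕ-fromℕ; toℕ<n)
  renaming (_≟_ to _≟ᶠ_)
open import Data.Fin.Subset using (Subset; _∈_; _∉_; _⊆_; _∩_; _∪_; ∣_∣; ⁅_⁆)
open import Data.Fin.Subset.Properties
  using (_∈?_; p⊆q⇒∣p∣≤∣q∣; x∈p∩q⁺; x∈p∩q⁻; x∈p∪q⁺; x∈p∪q⁻; x∈⁅x⁆; x∈⁅y⁆⇒x≡y; ∣⁅x⁆∣≡1;
         x∈p∧x≢y⇒x∈p-y; x∈p⇒∣p-x∣<∣p∣)
open import Data.Vec using (tabulate)
open import Data.Vec.Properties using (lookup∘tabulate; lookup⇒[]=; []=⇒lookup)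
open import Data.Product using (Σ; ∃; ∃₂; _×_; _,_; proj₁; proj₂)
open import Data.Sum using (_⊎_; inj₁; inj₂)
open import Data.Empty using (⊥; ⊥-elim)
open import Function using (_∘_)
open import Function.Bundles using (_⇔_; mk⇔)
open import Relation.Nullary using (¬_; Dec; yes; no; contradiction)
open import Relation.Nullary.Decidable using (_×-dec_; _⊎-dec_; ¬?; map′)
open import Relation.Binary.Definitions using (tri<; tri≈; tri>)
open import Relation.Binary.PropositionalEquality

collapse : ∀ {j s d} → j + s ≤ d → d + s ≤ j → s ≡ 0 × j ≡ d
collapse {j} {s} {d} j+s≤d d+s≤j = s≡0 , ≤-antisym j≤d (≤-trans (m≤m+n d s) d+s≤j)
  where
    j≤d : j ≤ d
    j≤d = ≤-trans (m≤m+n j s) j+s≤d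
    s≡0 : s ≡ 0
    s≡0 = n≤0⇒n≡0 (+-cancelˡ-≤ d s 0
            (≤-trans d+s≤j (≤-trans j≤d (≤-reflexive (sym (+-identityʳ d))))))

exchange : ∀ a b c → a + (b + c) ≡ b + (a + c)
exchange a b c = trans (sym (+-assoc a b c)) (trans (cong (_+ c) (+-comm a b)) (+-assoc b a c))

rotate : ∀ m j s → m + (j + s) ≡ m + s + j
rotate m j s = trans (cong (m +_) (+-comm j s)) (sym (+-assoc m s j))

-- Reading of "r < (p + 1) + j" with r = d + (p + s).
cancel-detour : ∀ {d p s j} → d + (p + s) < suc (p + j) → d + s ≤ j
cancel-detour {d} {p} {s} {j} lt =
  +-cancelˡ-≤ p (d + s) j (≤-pred (subst (_< suc (p + j)) (exchange d p s) lt))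

beyond-bound : ∀ {m j s r d} → d < j + s → m + (j + s) ≡ suc r → m ≤ r ∸ d
beyond-bound {m} {j} {s} {r} {d} d<j+s eq = m+n≤o⇒m≤o∸n m (≤-pred (begin
  suc (m + d)  ≡⟨ sym (+-suc m d) ⟩
  m + suc d    ≤⟨ +-monoʳ-≤ m d<j+s ⟩
  m + (j + s)  ≡⟨ eq ⟩
  suc r        ∎))
  where open ≤-Reasoning

overshoot : ∀ {m j s r} → j ≤ r → m + (j + s) ≡ suc r → ¬ (m + s ≤ r ∸ j)
overshoot {m} {j} {s} {r} j≤r eq m+s≤ =
  1+n≰n (subst (_≤ r) (trans (sym (rotate m j s)) eq) (m≤o∸n⇒m+n≤o (m + s) j≤r m+s≤))

∈-tabulate⁺ : ∀ {n} (f : Fin n → Bool) {x} → f x ≡ true → x ∈ tabulate f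
∈-tabulate⁺ f {x} fx≡true = lookup⇒[]= x (tabulate f) (trans (lookup∘tabulate f x) fx≡true)

∈-tabulate⁻ : ∀ {n} (f : Fin n → Bool) {x} → x ∈ tabulate f → f x ≡ true
∈-tabulate⁻ f {x} x∈ = trans (sym (lookup∘tabulate f x)) ([]=⇒lookup x∈)

member⇒1≤∣p∣ : ∀ {n} {p : Subset n} {x} → x ∈ p → 1 ≤ ∣ p ∣
member⇒1≤∣p∣ {p = p} {x} x∈p = subst (_≤ ∣ p ∣) (∣⁅x⁆∣≡1 x) (p⊆q⇒∣p∣≤∣q∣ ⁅x⁆⊆p)
  where
    ⁅x⁆⊆p : ⁅ x ⁆ ⊆ p
    ⁅x⁆⊆p {y} y∈⁅x⁆ = subst (_∈ p) (sym (x∈⁅y⁆⇒x≡y x y∈⁅x⁆)) x∈p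

two-members⇒2≤∣p∣ : ∀ {n} {p : Subset n} {x y} → x ≢ y → x ∈ p → y ∈ p → 2 ≤ ∣ p ∣
two-members⇒2≤∣p∣ x≢y x∈p y∈p =
  ≤-trans (s≤s (member⇒1≤∣p∣ (x∈p∧x≢y⇒x∈p-y y∈p (x≢y ∘ sym)))) (x∈p⇒∣p-x∣<∣p∣ x∈p)

another-member : ∀ {n} {p : Subset n} → 2 ≤ ∣ p ∣ → ∀ y → ∃ λ x → x ∈ p × x ≢ y
another-member {p = p} 2≤∣p∣ y with any? (λ x → x ∈? p ×-dec ¬? (x ≟ᶠ y))
... | yes found = found
... | no none = contradiction (≤-trans 2≤∣p∣ ∣p∣≤1) λ { (s≤s ()) }
  where
    p⊆⁅y⁆ : p ⊆ ⁅ y ⁆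
    p⊆⁅y⁆ {x} x∈p with x ≟ᶠ y
    ... | yes refl = x∈⁅x⁆ x
    ... | no x≢y = contradiction (x , x∈p , x≢y) none
    ∣p∣≤1 : ∣ p ∣ ≤ 1
    ∣p∣≤1 = subst (∣ p ∣ ≤_) (∣⁅x⁆∣≡1 y) (p⊆q⇒∣p∣≤∣q∣ p⊆⁅y⁆)

module Walks {n : ℕ} (H : Graph n) where

  private
    variable
      u v w x y p q : Fin n
      i j k ℓ : ℕ

  adj-sym : Adj H u v → Adj H v u
  adj-sym {u} {v} e = trans (Graph.sym H v u) e

  adj-irrefl : ¬ Adj H u u
  adj-irrefl {u} e with trans (sym (irrefl H u)) e
  ... | ()

  adj? : ∀ u v → Dec (Adj H u v)
  adj? u v = adj H u v ≟ᵇ true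

  _++_ : Walk H u v i → Walk H v w j → Walk H u w (i + j)
  nil ++ b = b
  cons e a ++ b = cons e (a ++ b)

  reverse-onto : Walk H x p i → Walk H x q j → Walk H p q (i + j)
  reverse-onto nil b = b
  reverse-onto {i = suc i} {j = j} (cons e a) b =
    subst (Walk H _ _) (+-suc i j) (reverse-onto a (cons (adj-sym e) b))

  reverse : Walk H u v k → Walk H v u k
  reverse {k = k} a = subst (Walk H _ _) (+-identityʳ k) (reverse-onto a nil)

  nil-ends : Walk H u v 0 → u ≡ v
  nil-ends nil = refl

  DistLe-refl : DistLe H u u 0
  DistLe-refl = 0 , z≤n , nil

  walk⇒DistLe : Walk H u v k → DistLe H u v k
  walk⇒DistLe a = _ , ≤-refl , a

  DistLe-mono : k ≤ ℓ → DistLe H u v k → DistLe H u v ℓ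
  DistLe-mono k≤ℓ (i , i≤k , a) = i , ≤-trans i≤k k≤ℓ , a

  DistLe-sym : DistLe H u v k → DistLe H v u k
  DistLe-sym (i , i≤k , a) = i , i≤k , reverse a

  DistLe-trans : DistLe H u v k → DistLe H v w ℓ → DistLe H u w (k + ℓ)
  DistLe-trans (i , i≤k , a) (j , j≤ℓ , b) = i + j , +-mono-≤ i≤k j≤ℓ , a ++ b

  DistLe-zero : DistLe H u v 0 → u ≡ v
  DistLe-zero (.0 , z≤n , a) = nil-ends a

  DistLe? : ∀ u v k → Dec (DistLe H u v k)
  DistLe? u v zero = map′ (λ { refl → DistLe-refl }) DistLe-zero (u ≟ᶠ v)
  DistLe? u v (suc k) =
    map′ unfold⁻ unfold⁺ ((u ≟ᶠ v) ⊎-dec any? (λ w → adj? u w ×-dec DistLe? w v k))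
    where
      unfold⁺ : DistLe H u v (suc k) → u ≡ v ⊎ ∃ λ w → Adj H u w × DistLe H w v k
      unfold⁺ (zero , _ , a) = inj₁ (nil-ends a)
      unfold⁺ (suc i , s≤s i≤k , cons e a) = inj₂ (_ , e , i , i≤k , a)
      unfold⁻ : u ≡ v ⊎ (∃ λ w → Adj H u w × DistLe H w v k) → DistLe H u v (suc k)
      unfold⁻ (inj₁ refl) = 0 , z≤n , nil
      unfold⁻ (inj₂ (_ , e , i , i≤k , a)) = suc i , s≤s i≤k , cons e a

  Dist-refl : Dist H u u 0
  Dist-refl = nil , λ _ ()

  Dist≤walk : Dist H u v k → Walk H u v j → k ≤ j
  Dist≤walk {k = k} {j = j} (_ , minimal) a with k ≤? j
  ... | yes k≤j = k≤j
  ... | no k≰j = contradiction a (minimal j (≰⇒> k≰j))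

  Dist≤DistLe : Dist H u v k → DistLe H u v ℓ → k ≤ ℓ
  Dist≤DistLe D (i , i≤ℓ , a) = ≤-trans (Dist≤walk D a) i≤ℓ

  Dist⇒DistLe : Dist H u v k → DistLe H u v k
  Dist⇒DistLe (a , _) = walk⇒DistLe a

  Dist⇒¬DistLe : Dist H u v k → ℓ < k → ¬ DistLe H u v ℓ
  Dist⇒¬DistLe D ℓ<k dl = <⇒≱ ℓ<k (Dist≤DistLe D dl)

  Dist-unique : Dist H u v k → Dist H u v ℓ → k ≡ ℓ
  Dist-unique D D′ = ≤-antisym (Dist≤walk D (proj₁ D′)) (Dist≤walk D′ (proj₁ D))

  Dist-sym : Dist H u v k → Dist H v u k
  Dist-sym (a , minimal) = reverse a , λ j j<k b → minimal j j<k (reverse b)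

  Dist-zero : Dist H u v 0 → u ≡ v
  Dist-zero (a , _) = nil-ends a

  Dist-self : Dist H u u k → k ≡ 0
  Dist-self D = n≤0⇒n≡0 (Dist≤walk D nil)

  shortest : ∀ L → DistLe H u v L → ∃ λ k → k ≤ L × Dist H u v k
  shortest zero dl with DistLe-zero dl
  ... | refl = 0 , z≤n , Dist-refl
  shortest {u} {v} (suc L) dl with DistLe? u v L
  ... | yes dl′ = let (k , k≤L , D) = shortest L dl′ in k , m≤n⇒m≤1+n k≤L , D
  ... | no ¬dl′ = suc L , ≤-refl , exact dl , λ j j≤L a → ¬dl′ (j , ≤-pred j≤L , a)
    where
      exact : DistLe H u v (suc L) → Walk H u v (suc L)
      exact (i , i≤ , a) with m≤n⇒m<n∨m≡n i≤
      ... | inj₁ i<1+L = contradiction (i , ≤-pred i<1+L , a) ¬dl′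
      ... | inj₂ refl = a

  FirstStepAvoids : Fin n → Walk H u v k → Set
  FirstStepAvoids z nil = ⊤
  FirstStepAvoids z (cons {w = y} _ _) = z ≢ y

  NonBacktracking : Walk H u v k → Set
  NonBacktracking nil = ⊤
  NonBacktracking (cons {u = x} _ a) = FirstStepAvoids x a × NonBacktracking a

  NonBacktracking-subst : ∀ {k′} (eq : k ≡ k′) (a : Walk H u v k) → NonBacktracking a →
                          NonBacktracking (subst (Walk H u v) eq a)
  NonBacktracking-subst refl a nb = nb

  BeforeEnd : (Fin n → Set) → Walk H u v k → Set
  BeforeEnd P nil = ⊤
  BeforeEnd P (cons {u = x} _ a) = P x × BeforeEnd P a

  record Shortening (a : Walk H u v k) : Set₁ where
    constructor shortening
    field
      {len}     : ℕ
      walk      : Walk H u v len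
      len≤      : len ≤ k
      nonBack   : NonBacktracking walk
      keeps     : ∀ {P} → BeforeEnd P a → BeforeEnd P walk

  shorten : (a : Walk H u v k) → Shortening a
  shorten nil = shortening nil z≤n tt (λ _ → tt)
  shorten (cons {u = x} e a) with shorten a
  ... | shortening nil _ _ keeps = shortening (cons e nil) (s≤s z≤n) (tt , tt) λ (Px , _) → Px , tt
  ... | shortening {suc len} (cons {w = z} e′ a′) len≤ (z′ , nb) keeps with x ≟ᶠ z
  ...   | yes refl = shortening a′ (m≤n⇒m≤1+n (≤-trans (n≤1+n len) len≤)) nb
                       λ (_ , Pa) → proj₂ (keeps Pa)
  ...   | no x≢z = shortening (cons e (cons e′ a′)) (s≤s len≤) (x≢z , z′ , nb)
                     λ (Px , Pa) → Px , keeps Pa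

  nonBacktracking-shortest : Dist H u v k → Σ (Walk H u v k) NonBacktracking
  nonBacktracking-shortest {u} {v} D with shorten (proj₁ D)
  ... | shortening a len≤ nb _ =
    subst (λ k → Σ (Walk H u v k) NonBacktracking) (≤-antisym len≤ (Dist≤walk D a)) (a , nb)

  Diverge : Walk H x p i → Walk H x q j → Set
  Diverge nil b = ⊤
  Diverge (cons {w = y} _ _) b = FirstStepAvoids y b

  reverse-onto-nonBacktracking : (a : Walk H x p i) (b : Walk H x q j) →
    NonBacktracking a → NonBacktracking b → Diverge a b → NonBacktracking (reverse-onto a b)
  reverse-onto-nonBacktracking nil b _ nbb _ = nbb
  reverse-onto-nonBacktracking {i = suc i} {j = j} (cons {u = x} {w = y} e a) b (x↛a , nba) nbb div =
    NonBacktracking-subst (+-suc i j) (reverse-onto a (cons (adj-sym e) b))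
      (reverse-onto-nonBacktracking a (cons (adj-sym e) b) nba (div , nbb) (turn a x↛a))
    where
      turn : ∀ {p i} (a : Walk H y p i) → FirstStepAvoids x a → Diverge a (cons {u = y} (adj-sym e) b)
      turn nil _ = tt
      turn (cons _ _) x≢a₂ = x≢a₂ ∘ sym

  vertices : Walk H u v k → Subset n
  vertices {u} nil = ⁅ u ⁆
  vertices {u} (cons _ a) = ⁅ u ⁆ ∪ vertices a

  start∈vertices : (a : Walk H u v k) → u ∈ vertices a
  start∈vertices {u} nil = x∈⁅x⁆ u
  start∈vertices {u} (cons _ a) = x∈p∪q⁺ (inj₁ (x∈⁅x⁆ u))

  TwoNeighboursIn : Subset n → Fin n → Set
  TwoNeighboursIn S y = ∃₂ λ y₁ y₂ → y₁ ≢ y₂ × Adj H y y₁ × Adj H y y₂ × y₁ ∈ S × y₂ ∈ S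

  two-neighbours-mono : ∀ {S T} → S ⊆ T → TwoNeighboursIn S y → TwoNeighboursIn T y
  two-neighbours-mono S⊆T (y₁ , y₂ , y₁≢y₂ , e₁ , e₂ , y₁∈S , y₂∈S) =
    y₁ , y₂ , y₁≢y₂ , e₁ , e₂ , S⊆T y₁∈S , S⊆T y₂∈S

  inner-two-neighbours : (a : Walk H x p k) → NonBacktracking a →
    y ∈ vertices a → y ≢ x → y ≢ p → TwoNeighboursIn (vertices a) y
  inner-two-neighbours {x} {y = y} nil _ y∈ y≢x _ = contradiction (x∈⁅y⁆⇒x≡y x y∈) y≢x
  inner-two-neighbours {x} {y = y} (cons {w = a₁} e a) (_ , nb) y∈ y≢x y≢p
    with x∈p∪q⁻ ⁅ x ⁆ (vertices a) y∈
  ... | inj₁ y∈⁅x⁆ = contradiction (x∈⁅y⁆⇒x≡y x y∈⁅x⁆) y≢x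
  ... | inj₂ y∈a with y ≟ᶠ a₁
  ...   | no y≢a₁ = two-neighbours-mono (λ z∈ → x∈p∪q⁺ (inj₂ z∈))
                      (inner-two-neighbours a nb y∈a y≢a₁ y≢p)
  inner-two-neighbours (cons e nil) _ _ _ y≢p | inj₂ _ | yes refl = contradiction refl y≢p
  inner-two-neighbours {x} (cons e (cons {w = a₂} e′ a)) (x≢a₂ , _) _ _ _ | inj₂ _ | yes refl =
    x , a₂ , x≢a₂ , adj-sym e , e′ ,
    x∈p∪q⁺ (inj₁ (x∈⁅x⁆ x)) , x∈p∪q⁺ (inj₂ (x∈p∪q⁺ (inj₂ (start∈vertices a))))

module ShortCycles {n : ℕ} (H : Graph n) where

  open Walks H

  private
    variable
      x y z : Fin n
      j k L : ℕ

  CycleWithin : ℕ → Set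
  CycleWithin L = Σ (Cycle H) λ c → cycleLength c ≤ L

  Steps : (ℕ → Fin n) → ℕ → Set
  Steps f L = ∀ t → t < L → Adj H (f t) (f (suc t))

  NoReturn : (ℕ → Fin n) → ℕ → Set
  NoReturn f L = ∀ t → 2 + t ≤ L → f t ≢ f (2 + t)

  Repetition : (ℕ → Fin n) → ℕ → Set
  Repetition f L = ∃ λ t → t < L × ∃ λ s → s < t × f s ≡ f t

  repetition? : ∀ f L → Dec (Repetition f L)
  repetition? f = anyUpTo? (λ t → anyUpTo? (λ s → f s ≟ᶠ f t) t)

  no-repetition⇒injective : ∀ {f L} → ¬ Repetition f L →
                            ∀ (a b : Fin L) → f (toℕ a) ≡ f (toℕ b) → a ≡ b
  no-repetition⇒injective {f} none a b fa≡fb with <-cmp (toℕ a) (toℕ b)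
  ... | tri< a<b _ _ = contradiction (toℕ b , toℕ<n b , toℕ a , a<b , fa≡fb) none
  ... | tri≈ _ a≡b _ = toℕ-injective a≡b
  ... | tri> _ _ b<a = contradiction (toℕ a , toℕ<n a , toℕ b , b<a , sym fa≡fb) none

  injective-sequence⇒cycle : ∀ L f → Steps f (3 + L) → f (3 + L) ≡ f 0 →
    (∀ (a b : Fin (3 + L)) → f (toℕ a) ≡ f (toℕ b) → a ≡ b) → CycleWithin (3 + L)
  injective-sequence⇒cycle L f steps closed injective = cycle , ≤-refl
    where
      cycle : Cycle H
      cycle = record
        { m     = L
        ; vert  = f ∘ toℕ
        ; inj   = injective _ _
        ; step  = λ i → subst (λ t → Adj H (f t) (f (suc (toℕ i)))) (sym (toℕ-inject₁ i))
                              (steps (toℕ i) (m≤n⇒m≤1+n (toℕ<n i)))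
        ; close = subst (λ t → Adj H (f t) (f 0)) (sym (toℕ-fromℕ (2 + L)))
                        (subst (Adj H (f (2 + L))) closed (steps (2 + L) ≤-refl))
        }

  steps-shift : ∀ {f L} s {k} → s + k ≤ L → Steps f L → Steps (λ t → f (s + t)) k
  steps-shift {f} s s+k≤L steps t t<k =
    subst (λ t′ → Adj H (f (s + t)) (f t′)) (sym (+-suc s t))
          (steps (s + t) (<-≤-trans (+-monoʳ-< s t<k) s+k≤L))

  noReturn-shift : ∀ {f L} s {k} → s + k ≤ L → NoReturn f L → NoReturn (λ t → f (s + t)) k
  noReturn-shift {f} {L} s s+k≤L noReturn t 2+t≤k =
    subst (λ t′ → f (s + t) ≢ f t′) (sym shift-2)
          (noReturn (s + t) (subst (_≤ L) shift-2 (≤-trans (+-monoʳ-≤ s 2+t≤k) s+k≤L)))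
    where
      shift-2 : s + (2 + t) ≡ 2 + (s + t)
      shift-2 = trans (+-suc s (suc t)) (cong suc (+-suc s t))

  -- A closed sequence of length L ≥ 1 without immediate returns contains a cycle of
  -- length ≤ L: take it if it has no repetition, otherwise recurse on the closed
  -- window between two equal entries.  N bounds L and makes the recursion structural.
  closed-sequence⇒cycle : ∀ N L f → L ≤ N → 1 ≤ L → Steps f L → NoReturn f L →
                          f L ≡ f 0 → CycleWithin L
  closed-sequence⇒cycle N 1 f _ _ steps _ closed =
    ⊥-elim (adj-irrefl (subst (Adj H (f 0)) closed (steps 0 ≤-refl)))
  closed-sequence⇒cycle N 2 f _ _ _ noReturn closed = ⊥-elim (noReturn 0 ≤-refl (sym closed))
  closed-sequence⇒cycle (suc N) (suc (suc (suc L))) f L≤N _ steps noReturn closed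
    with repetition? f (3 + L)
  ... | no none = injective-sequence⇒cycle L f steps closed (no-repetition⇒injective none)
  ... | yes (t , t<L , s , s<t , fs≡ft) =
    let (c , len≤) = closed-sequence⇒cycle N (t ∸ s) (λ x → f (s + x))
                       (≤-pred (≤-trans (s≤s (m∸n≤m t s)) (≤-trans t<L L≤N)))
                       (m<n⇒0<n∸m s<t)
                       (steps-shift s window steps) (noReturn-shift s window noReturn)
                       (trans (cong f s+[t∸s]≡t) (trans (sym fs≡ft) (cong f (sym (+-identityʳ s)))))
    in c , ≤-trans len≤ (≤-trans (m∸n≤m t s) (<⇒≤ t<L))
    where
      s+[t∸s]≡t : s + (t ∸ s) ≡ t
      s+[t∸s]≡t = m+[n∸m]≡n (<⇒≤ s<t)
      window : s + (t ∸ s) ≤ 3 + L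
      window = subst (_≤ 3 + L) (sym s+[t∸s]≡t) (<⇒≤ t<L)

  vertexAt : Walk H x y k → ℕ → Fin n
  vertexAt {x} nil _ = x
  vertexAt {x} (cons _ _) zero = x
  vertexAt (cons _ a) (suc t) = vertexAt a t

  vertexAt-start : (a : Walk H x y k) → vertexAt a 0 ≡ x
  vertexAt-start nil = refl
  vertexAt-start (cons _ _) = refl

  vertexAt-end : (a : Walk H x y k) → vertexAt a k ≡ y
  vertexAt-end nil = refl
  vertexAt-end (cons _ a) = vertexAt-end a

  vertexAt-steps : (a : Walk H x y k) → Steps (vertexAt a) k
  vertexAt-steps (cons {u = x} e a) zero _ = subst (Adj H x) (sym (vertexAt-start a)) e
  vertexAt-steps (cons _ a) (suc t) (s≤s t<k) = vertexAt-steps a t t<k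

  vertexAt-noReturn : (a : Walk H x y k) → NonBacktracking a → NoReturn (vertexAt a) k
  vertexAt-noReturn (cons _ (cons _ a)) (x≢a₂ , _) zero _ = λ x≡a₂ → x≢a₂ (trans x≡a₂ (vertexAt-start a))
  vertexAt-noReturn (cons _ a) (_ , nb) (suc t) (s≤s 2+t≤k) = vertexAt-noReturn a nb t 2+t≤k

  closed-nonBacktracking⇒cycle : (a : Walk H z z L) → NonBacktracking a → 1 ≤ L → CycleWithin L
  closed-nonBacktracking⇒cycle {L = L} a nb 1≤L =
    closed-sequence⇒cycle L L (vertexAt a) ≤-refl 1≤L (vertexAt-steps a) (vertexAt-noReturn a nb)
      (trans (vertexAt-end a) (sym (vertexAt-start a)))

  -- Two non-backtracking walks with the same ends but different lengths yield, after
  -- discarding their common beginning, a non-trivial closed non-backtracking walk.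
  different-lengths⇒closed-walk : (a : Walk H x y k) (b : Walk H x y j) →
    NonBacktracking a → NonBacktracking b → k ≢ j →
    ∃₂ λ z L → 1 ≤ L × L ≤ k + j × Σ (Walk H z z L) NonBacktracking
  different-lengths⇒closed-walk nil nil _ _ k≢j = contradiction refl k≢j
  different-lengths⇒closed-walk nil (cons f b) _ nbb _ = _ , _ , s≤s z≤n , ≤-refl , cons f b , nbb
  different-lengths⇒closed-walk (cons e a) nil nba _ _ =
    _ , _ , s≤s z≤n , ≤-reflexive (sym (+-identityʳ _)) , cons e a , nba
  different-lengths⇒closed-walk {k = suc k} {j = suc j} (cons {w = a₁} e a) (cons {w = b₁} f b)
                                (a′ , nba) (b′ , nbb) k≢j with a₁ ≟ᶠ b₁
  ... | yes refl =
    let (z , L , 1≤L , L≤ , c) = different-lengths⇒closed-walk a b nba nbb (k≢j ∘ cong suc)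
    in z , L , 1≤L , ≤-trans L≤ (+-mono-≤ (n≤1+n k) (n≤1+n j)) , c
  ... | no a₁≢b₁ =
    _ , _ , s≤s z≤n , ≤-reflexive (+-comm (suc j) (suc k)) , reverse-onto (cons f b) (cons e a) ,
    reverse-onto-nonBacktracking (cons f b) (cons e a) (b′ , nbb) (a′ , nba) (a₁≢b₁ ∘ sym)

  nonBacktracking-lengths-agree : ∀ {g} → GirthAtLeast H g → (a : Walk H x y k) (b : Walk H x y j) →
    NonBacktracking a → NonBacktracking b → k + j < g → k ≡ j
  nonBacktracking-lengths-agree {k = k} {j = j} girth a b nba nbb k+j<g with k ≟ j
  ... | yes k≡j = k≡j
  ... | no k≢j with different-lengths⇒closed-walk a b nba nbb k≢j
  ... | _ , _ , 1≤L , L≤k+j , c , nbc with closed-nonBacktracking⇒cycle c nbc 1≤L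
  ... | cycle , len≤L = contradiction (≤-trans (girth cycle) (≤-trans len≤L L≤k+j)) (<⇒≱ k+j<g)

  nonBacktracking-geodesic : ∀ {g} → GirthAtLeast H g → (a : Walk H x y k) → NonBacktracking a →
                             2 * k ≤ g → Dist H x y k
  nonBacktracking-geodesic {x = x} {y = y} {k = k} girth a nb 2k≤g = a , no-shorter
    where
      no-shorter : ∀ j → j < k → ¬ Walk H x y j
      no-shorter j j<k b with shorten b
      ... | shortening {len} b′ len≤j nb′ _ =
        <⇒≢ len<k (sym (nonBacktracking-lengths-agree girth a b′ nb nb′ (<-≤-trans k+len<2k 2k≤g)))
        where
          len<k : len < k
          len<k = ≤-<-trans len≤j j<k
          k+len<2k : k + len < 2 * k
          k+len<2k = subst (k + len <_) (cong (k +_) (sym (+-identityʳ k))) (+-monoʳ-< k len<k)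

module Core {n : ℕ} (H : Graph n) (C : Subset n) (core : IsCore H C) where

  open Walks H

  private
    variable
      u v x y b p q : Fin n
      i j k ℓ L : ℕ

  -- A set containing the core in which every non-core vertex has two neighbours has
  -- minimum degree two, hence lies inside the core.
  core-absorbs : ∀ S → C ⊆ S → (∀ {z} → z ∈ S → z ∉ C → TwoNeighboursIn S z) → S ⊆ C
  core-absorbs S C⊆S two-neighbours = proj₂ core S minDeg2
    where
      minDeg2 : MinDeg2 H S
      minDeg2 z z∈S with z ∈? C
      ... | yes z∈C = ≤-trans (proj₁ core z z∈C) (p⊆q⇒∣p∣≤∣q∣ enlarge)
        where
          enlarge : Nbhd H z ∩ C ⊆ Nbhd H z ∩ S
          enlarge y∈ = let (z∼y , y∈C) = x∈p∩q⁻ (Nbhd H z) C y∈ in x∈p∩q⁺ (z∼y , C⊆S y∈C)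
      ... | no z∉C with two-neighbours z∈S z∉C
      ... | y₁ , y₂ , y₁≢y₂ , e₁ , e₂ , y₁∈S , y₂∈S =
        two-members⇒2≤∣p∣ y₁≢y₂ (x∈p∩q⁺ (∈-tabulate⁺ (adj H z) e₁ , y₁∈S))
                                 (x∈p∩q⁺ (∈-tabulate⁺ (adj H z) e₂ , y₂∈S))

  OffCore : Walk H u v k → Set
  OffCore = BeforeEnd (_∉ C)

  offCore-from-core : (a : Walk H u v k) → OffCore a → u ∈ C → u ≡ v
  offCore-from-core nil _ _ = refl
  offCore-from-core (cons _ _) (u∉C , _) u∈C = contradiction u∈C u∉C

  -- Two non-backtracking off-core walks from a non-core vertex enter the core at the
  -- same vertex: where they separate, the core together with both walks would be a
  -- set of minimum degree two containing the non-core separation vertex.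
  entry-unique-nonBacktracking : (a : Walk H x p i) (b : Walk H x q j) → x ∉ C →
    NonBacktracking a → NonBacktracking b → OffCore a → OffCore b → p ∈ C → q ∈ C → p ≡ q
  entry-unique-nonBacktracking nil _ x∉C _ _ _ _ p∈C _ = contradiction p∈C x∉C
  entry-unique-nonBacktracking (cons _ _) nil x∉C _ _ _ _ _ q∈C = contradiction q∈C x∉C
  entry-unique-nonBacktracking (cons {w = a₁} e a) (cons {w = b₁} f b) x∉C
    (a′ , nba) (b′ , nbb) (_ , offa) (_ , offb) p∈C q∈C with a₁ ≟ᶠ b₁
  ... | yes refl with a₁ ∈? C
  ...   | yes a₁∈C = trans (sym (offCore-from-core a offa a₁∈C)) (offCore-from-core b offb a₁∈C)
  ...   | no a₁∉C = entry-unique-nonBacktracking a b a₁∉C nba nbb offa offb p∈C q∈C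
  entry-unique-nonBacktracking {x = x} {p = p} {i = suc i} {q = q} {j = suc j}
    (cons {w = a₁} e a) (cons {w = b₁} f b) x∉C
    (a′ , nba) (b′ , nbb) _ _ p∈C q∈C | no a₁≢b₁ =
    contradiction (core-absorbs S (λ z∈C → x∈p∪q⁺ (inj₁ z∈C)) two-neighbours (inA (start∈vertices a₀))) x∉C
    where
      a₀ : Walk H x p (suc i)
      a₀ = cons e a
      b₀ : Walk H x q (suc j)
      b₀ = cons f b
      S : Subset n
      S = C ∪ (vertices a₀ ∪ vertices b₀)
      inA : vertices a₀ ⊆ S
      inA z∈ = x∈p∪q⁺ (inj₂ (x∈p∪q⁺ (inj₁ z∈)))
      inB : vertices b₀ ⊆ S
      inB z∈ = x∈p∪q⁺ (inj₂ (x∈p∪q⁺ (inj₂ z∈)))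
      two-neighbours : ∀ {z} → z ∈ S → z ∉ C → TwoNeighboursIn S z
      two-neighbours {z} z∈S z∉C with z ≟ᶠ x | x∈p∪q⁻ C _ z∈S
      ... | yes refl | _ = a₁ , b₁ , a₁≢b₁ , e , f ,
                           inA (x∈p∪q⁺ (inj₂ (start∈vertices a))) , inB (x∈p∪q⁺ (inj₂ (start∈vertices b)))
      ... | no _ | inj₁ z∈C = contradiction z∈C z∉C
      ... | no z≢x | inj₂ z∈ab with x∈p∪q⁻ (vertices a₀) (vertices b₀) z∈ab
      ...   | inj₁ z∈a = two-neighbours-mono inA
                           (inner-two-neighbours a₀ (a′ , nba) z∈a z≢x λ { refl → z∉C p∈C })
      ...   | inj₂ z∈b = two-neighbours-mono inB
                           (inner-two-neighbours b₀ (b′ , nbb) z∈b z≢x λ { refl → z∉C q∈C })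

  -- The same holds for arbitrary off-core walks, after shortening them.
  entry-unique : (a : Walk H x p i) (b : Walk H x q j) → x ∉ C →
                 OffCore a → OffCore b → p ∈ C → q ∈ C → p ≡ q
  entry-unique a b x∉C offa offb p∈C q∈C with shorten a | shorten b
  ... | shortening a′ _ nba keepa | shortening b′ _ nbb keepb =
    entry-unique-nonBacktracking a′ b′ x∉C nba nbb (keepa offa) (keepb offb) p∈C q∈C

  record CoreEntry (u b : Fin n) (L : ℕ) : Set where
    constructor coreEntry
    field
      {entry}        : Fin n
      {before after} : ℕ
      entry∈C        : entry ∈ C
      approach       : Walk H u entry before
      approach-off   : OffCore approach
      rest           : Walk H entry b after
      splits         : before + after ≡ L

  first-entry : Walk H u b L → b ∈ C → CoreEntry u b L
  first-entry {u} a b∈C with u ∈? C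
  ... | yes u∈C = coreEntry u∈C nil tt a refl
  first-entry nil b∈C | no u∉C = contradiction b∈C u∉C
  first-entry (cons e a) b∈C | no u∉C with first-entry a b∈C
  ... | coreEntry c∈C approach off rest splits =
    coreEntry c∈C (cons e approach) (u∉C , off) rest (cong suc splits)

  AttachedAt : Fin n → Fin n → ℕ → Set
  AttachedAt u w j = Dist H u w j × (∀ {b L} → b ∈ C → DistLe H u b L → j ≤ L × DistLe H w b (L ∸ j))

  attachment : Connected H → v ∈ C → ∀ u → ∃₂ λ w j → w ∈ C × AttachedAt u w j
  attachment {v} conn v∈C u with u ∈? C
  ... | yes u∈C = u , 0 , u∈C , Dist-refl , λ _ dl → z≤n , dl
  ... | no u∉C with first-entry (proj₂ (conn u v)) v∈C
  ... | coreEntry {w} w∈C approach off _ _ with shortest _ (walk⇒DistLe approach)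
  ... | j , _ , Duw = w , j , w∈C , Duw , through
    where
      through : b ∈ C → DistLe H u b L → j ≤ L × DistLe H w b (L ∸ j)
      through {L = L} b∈C (k , k≤L , a) with first-entry a b∈C
      ... | coreEntry {before = i} {after = m} w′∈C approach′ off′ rest splits
        with entry-unique approach approach′ u∉C off off′ w∈C w′∈C
      ... | refl = j≤L , m , m≤L∸j , rest
        where
          j≤i : j ≤ i
          j≤i = Dist≤walk Duw approach′
          i+m≤L : i + m ≤ L
          i+m≤L = subst (_≤ L) (sym splits) k≤L
          j≤L : j ≤ L
          j≤L = ≤-trans j≤i (≤-trans (m≤m+n i m) i+m≤L)
          m≤L∸j : m ≤ L ∸ j
          m≤L∸j = m+n≤o⇒m≤o∸n m (≤-trans (+-monoʳ-≤ m j≤i) (subst (_≤ L) (+-comm i m) i+m≤L))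

  second-vertex : Walk H u v k → Fin n
  second-vertex {u} nil = u
  second-vertex (cons {w = y} _ _) = y

  first-step-avoids : ∀ {z} (a : Walk H u v k) → z ≢ second-vertex a → FirstStepAvoids z a
  first-step-avoids nil _ = tt
  first-step-avoids (cons _ _) z≢y = z≢y

  -- Non-backtracking walks starting in the core can be prolonged backwards inside the
  -- core by any number of steps, since every core vertex has two core neighbours.
  extend-back : ∀ m (a : Walk H x y ℓ) → NonBacktracking a → x ∈ C →
    ∃ λ b → b ∈ C × Σ (Walk H b y (m + ℓ)) NonBacktracking × Walk H b x m
  extend-back zero a nb x∈C = _ , x∈C , (a , nb) , nil
  extend-back (suc m) a nb x∈C with extend-back m a nb x∈C
  ... | b , b∈C , (a′ , nb′) , b⇝x with another-member (proj₁ core b b∈C) (second-vertex a′)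
  ... | b₂ , b₂∈ , b₂≢next with x∈p∩q⁻ (Nbhd H b) C b₂∈
  ... | b∼b₂ , b₂∈C = b₂ , b₂∈C , (cons e a′ , first-step-avoids a′ b₂≢next , nb′) , cons e b⇝x
    where
      e : Adj H b₂ b
      e = adj-sym (∈-tabulate⁻ (adj H b) b∼b₂)

module PendantTrees {n : ℕ} (H : Graph n) (C : Subset n) (core : IsCore H C)
                    (conn : Connected H) (r : ℕ) (girth : GirthAtLeast H (2 * r + 3)) where

  open Walks H
  open ShortCycles H
  open Core H C core

  private
    variable
      a u w x y : Fin n
      j s ℓ : ℕ

  B⇒DistLe : B H r a u → DistLe H u a r
  B⇒DistLe (inj₁ refl) = DistLe-mono z≤n DistLe-refl
  B⇒DistLe (inj₂ (_ , dl)) = DistLe-sym dl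

  DistLe⇒B : DistLe H a u r → B H r a u
  DistLe⇒B {a} {u} dl with u ≟ᶠ a
  ... | yes u≡a = inj₁ u≡a
  ... | no u≢a = inj₂ (u≢a ∘ sym , dl)

  within-half-girth : ∀ {k} → k ≤ suc r → 2 * k ≤ 2 * r + 3
  within-half-girth {k} k≤1+r = begin
    2 * k          ≤⟨ *-monoʳ-≤ 2 k≤1+r ⟩
    2 * suc r      ≡⟨ *-suc 2 r ⟩
    2 + 2 * r      ≤⟨ n≤1+n _ ⟩
    3 + 2 * r      ≡⟨ +-comm 3 (2 * r) ⟩
    2 * r + 3      ∎
    where open ≤-Reasoning

  core-vertex-behind : x ∈ C → Dist H x y ℓ → ∀ m → m + ℓ ≤ suc r →
    ∃ λ b → b ∈ C × DistLe H b x m × Dist H b y (m + ℓ)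
  core-vertex-behind x∈C Dxy m m+ℓ≤1+r with nonBacktracking-shortest Dxy
  ... | a , nb with extend-back m a nb x∈C
  ... | b , b∈C , (a′ , nb′) , b⇝x =
    b , b∈C , walk⇒DistLe b⇝x , nonBacktracking-geodesic girth a′ nb′ (within-half-girth m+ℓ≤1+r)

  module Characterisation {v : Fin n} (v∈C : v ∈ C) {d : ℕ} (1≤d : 1 ≤ d) (d≤r : d ≤ r)
                          (u : Fin n) where

    InBalls : Set
    InBalls = ∀ a → a ∈ C → DistLe H v a (r ∸ d) → B H r a u

    OutsideBalls : Set
    OutsideBalls = ∀ b → b ∈ C → ¬ DistLe H v b (r ∸ d) → ¬ B H r b u

    -- If u ∈ T_v^(d), the attachment root of u is no farther than v, hence it is the
    -- closest core vertex v, at height d.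
    inTd⇒attached : InTd H C v d u → AttachedAt u v d
    inTd⇒attached (inj₁ refl , Dvu) = contradiction (subst (1 ≤_) (Dist-self Dvu) 1≤d) λ ()
    inTd⇒attached (inj₂ (_ , _ , closer) , Dvu) with attachment conn v∈C u
    ... | w , j , w∈C , Duw , through with w ≟ᶠ v
    ... | no w≢v = contradiction (proj₁ (through v∈C (Dist⇒DistLe (Dist-sym Dvu))))
                                 (<⇒≱ (closer w w∈C w≢v j d Duw (Dist-sym Dvu)))
    ... | yes refl with Dist-unique Duw (Dist-sym Dvu)
    ... | refl = Duw , through

    -- Conversely, v is then the strictly closest core vertex: a core vertex a with
    -- dist(u, a) = d lies within distance d - d = 0 of v.
    attached⇒inTd : AttachedAt u v d → InTd H C v d u
    attached⇒inTd (Duv , through) = inj₂ (u∉C , v∈C , closer) , Dist-sym Duv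
      where
        u∉C : u ∉ C
        u∉C u∈C = <⇒≱ 1≤d (proj₁ (through u∈C DistLe-refl))
        strictly-closer : ∀ {a da} → a ∈ C → a ≢ v → Dist H u a da → d < da
        strictly-closer a∈C a≢v Dua with through a∈C (Dist⇒DistLe Dua)
        ... | d≤da , v⇝a with m≤n⇒m<n∨m≡n d≤da
        ...   | inj₁ d<da = d<da
        ...   | inj₂ refl = contradiction (sym (DistLe-zero (subst (DistLe H v _) (n∸n≡0 d) v⇝a))) a≢v
        closer : ∀ a → a ∈ C → a ≢ v → ∀ da dv → Dist H u a da → Dist H u v dv → dv < da
        closer a a∈C a≢v da dv Dua Duv′ = subst (_< da) (Dist-unique Duv Duv′) (strictly-closer a∈C a≢v Dua)

    attached⇒balls : AttachedAt u v d → InBalls × OutsideBalls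
    attached⇒balls (Duv , through) = in-balls , outside-balls
      where
        in-balls : InBalls
        in-balls a a∈C v⇝a = DistLe⇒B (DistLe-mono (≤-reflexive (m∸n+n≡m d≤r))
                               (DistLe-trans (DistLe-sym v⇝a) (Dist⇒DistLe (Dist-sym Duv))))
        outside-balls : OutsideBalls
        outside-balls b b∈C far u∈Bb = far (proj₂ (through b∈C (B⇒DistLe u∈Bb)))

    root-close : InBalls → OutsideBalls → w ∈ C → AttachedAt u w j →
                 ∃ λ s → Dist H w v s × j + s ≤ r × s ≤ r ∸ d
    root-close {w} {j} in-balls outside-balls w∈C (Duw , through)
      with through v∈C (B⇒DistLe (in-balls v v∈C (DistLe-mono z≤n DistLe-refl)))
    ... | j≤r , w⇝v with shortest _ w⇝v
    ... | s , s≤r∸j , Dwv = s , Dwv , subst (_≤ r) (+-comm s j) (m≤o∸n⇒m+n≤o s j≤r s≤r∸j) , s≤r∸d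
      where
        s≤r∸d : s ≤ r ∸ d
        s≤r∸d with s ≤? r ∸ d
        ... | yes s≤r∸d = s≤r∸d
        ... | no s≰r∸d = contradiction (DistLe⇒B (DistLe-mono j≤r (Dist⇒DistLe (Dist-sym Duw))))
                           (outside-balls w w∈C (Dist⇒¬DistLe (Dist-sym Dwv) (≰⇒> s≰r∸d)))

    -- A core vertex b behind w at distance r - d + 1 from v is excluded by the second
    -- condition, so u ∉ B_b; but b reaches u through w in (r - d - s + 1) + j steps,
    -- hence that number exceeds r, that is d + s ≤ j.
    height-lower : OutsideBalls → w ∈ C → Dist H u w j → Dist H w v s → s ≤ r ∸ d → d + s ≤ j
    height-lower {w} {j} {s} outside-balls w∈C Duw Dwv s≤r∸d =
      conclude (core-vertex-behind w∈C Dwv (suc p) (s≤s (≤-trans (≤-reflexive p+s≡r∸d) (m∸n≤m r d))))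
      where
        p : ℕ
        p = r ∸ d ∸ s
        p+s≡r∸d : p + s ≡ r ∸ d
        p+s≡r∸d = m∸n+n≡m s≤r∸d
        r≡d+[p+s] : r ≡ d + (p + s)
        r≡d+[p+s] = trans (sym (m+[n∸m]≡n d≤r)) (cong (d +_) (sym p+s≡r∸d))
        conclude : (∃ λ b → b ∈ C × DistLe H b w (suc p) × Dist H b v (suc p + s)) → d + s ≤ j
        conclude (b , b∈C , b⇝w , Dbv) = cancel-detour {d} {p} {s} {j} (subst (_< suc (p + j)) r≡d+[p+s] (≰⇒> too-long))
          where
            far : ¬ DistLe H v b (r ∸ d)
            far = Dist⇒¬DistLe (Dist-sym Dbv) (s≤s (≤-reflexive (sym p+s≡r∸d)))
            too-long : ¬ (suc p + j ≤ r)
            too-long h = outside-balls b b∈C far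
                           (DistLe⇒B (DistLe-mono h (DistLe-trans b⇝w (Dist⇒DistLe (Dist-sym Duw)))))

    -- If d < j + s, a core vertex b behind v with dist(b, w) = r + 1 - j lies within
    -- r - d of v, so u ∈ B_b; rerouting a walk from u to b through w then gives
    -- dist(w, b) ≤ r - j, a contradiction.  Hence j + s ≤ d.
    height-upper : InBalls → AttachedAt u w j → Dist H w v s → j + s ≤ r → j + s ≤ d
    height-upper {w} {j} {s} in-balls (_ , through) Dwv j+s≤r =
      ≮⇒≥ λ d<j+s → absurd d<j+s (core-vertex-behind v∈C (Dist-sym Dwv) t t+s≤1+r)
      where
        t : ℕ
        t = suc r ∸ (j + s)
        t+[j+s]≡1+r : t + (j + s) ≡ suc r
        t+[j+s]≡1+r = m∸n+n≡m (m≤n⇒m≤1+n j+s≤r)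
        t+s≤1+r : t + s ≤ suc r
        t+s≤1+r = ≤-trans (+-monoʳ-≤ t (m≤n+m s j)) (≤-reflexive t+[j+s]≡1+r)
        absurd : d < j + s → (∃ λ b → b ∈ C × DistLe H b v t × Dist H b w (t + s)) → ⊥
        absurd d<j+s (b , b∈C , b⇝v , Dbw) =
          overshoot {t} {j} {s} {r} (≤-trans (m≤m+n j s) j+s≤r) t+[j+s]≡1+r
            (Dist≤DistLe (Dist-sym Dbw) (proj₂ (through b∈C u⇝b)))
          where
            u⇝b : DistLe H u b r
            u⇝b = B⇒DistLe (in-balls b b∈C
                    (DistLe-mono (beyond-bound {t} {j} {s} {r} {d} d<j+s t+[j+s]≡1+r) (DistLe-sym b⇝v)))

    root-is-v : InBalls → OutsideBalls → w ∈ C → AttachedAt u w j → w ≡ v × j ≡ d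
    root-is-v in-balls outside-balls w∈C attached@(Duw , _) =
      let (s , Dwv , j+s≤r , s≤r∸d) = root-close in-balls outside-balls w∈C attached
          (s≡0 , j≡d) = collapse (height-upper in-balls attached Dwv j+s≤r)
                                 (height-lower outside-balls w∈C Duw Dwv s≤r∸d)
      in Dist-zero (subst (Dist H _ v) s≡0 Dwv) , j≡d

    balls⇒attached : InBalls × OutsideBalls → AttachedAt u v d
    balls⇒attached (in-balls , outside-balls) =
      let (w , j , w∈C , attached) = attachment conn v∈C u
          (w≡v , j≡d) = root-is-v in-balls outside-balls w∈C attached
      in subst₂ (AttachedAt u) w≡v j≡d attached

lemma5 : ∀ {n} (r : ℕ) → 1 ≤ r → (H : Graph n) → Connected H →
         GirthAtLeast H (2 * r + 3) → ¬ IsTree H →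
         (C : Subset n) → IsCore H C →
         ∀ v → v ∈ C → ∀ d → 1 ≤ d → d ≤ r → ∀ u →
         InTd H C v d u ⇔
           ((∀ a → a ∈ C → DistLe H v a (r ∸ d) → B H r a u) ×
            (∀ b → b ∈ C → ¬ DistLe H v b (r ∸ d) → ¬ B H r b u))
lemma5 r _ H conn girth _ C core v v∈C d 1≤d d≤r u =
  mk⇔ (attached⇒balls ∘ inTd⇒attached) (attached⇒inTd ∘ balls⇒attached)
  where
    open PendantTrees H C core conn r girth
    open Characterisation v∈C 1≤d d≤r u
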